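{- Let $G$ be a prereduced graph and $W$ an induced subgraph of $G$ that is a $\dagger$-AW $(s:c:l,B,r)$ or a $\ddagger$-AW $(s:c_1,c_2:l,B,r)$. Then every vertex $x$ of $G$ adjacent to every vertex of the base $B$ is adjacent to the shallow terminal $s$.
   Context: Graphs are finite, simple, undirected. A minimal forbidden set is $X\subseteq V(G)$ with $G[X]$ not an interval graph but every proper subset inducing an interval graph; $G$ is prereduced if it has no minimal forbidden set of at most $10$ vertices. A $\dagger$-AW $(s:c:l,B,r)$, $B=\{b_1,\dots,b_d\}$, $d\ge 3$, $b_0=l$, $b_{d+1}=r$: vertices $s,c,b_0,\dots,b_{d+1}$ with edges exactly $b_ib_{i+1}$ $(0\le i\le d)$, $cs$, $cb_i$ $(1\le i\le d)$. A $\ddagger$-AW $(s:c_1,c_2:l,B,r)$, $d\ge 2$: vertices $s,c_1,c_2,b_0,\dots,b_{d+1}$ with edges exactly $b_ib_{i+1}$, $c_1c_2$, $c_1s$, $c_2s$, $c_1l$, $c_2r$, $c_jb_i$ ($j=1,2$, $1\le i\le d$). Here $s$ is the shallow terminal and $B$ the base. -}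

module Defs where

open import Data.Nat using (ℕ; zero; suc; _≤_)
open import Data.Fin using (Fin; toℕ)
open import Data.Fin.Subset using (Subset; _∈_; _⊂_; ∣_∣)
open import Data.Bool using (Bool; true; false)
open import Data.Rational using (ℚ) renaming (_≤_ to _≤ℚ_)
open import Data.Product using (Σ; _×_; _,_)
open import Data.Sum using (_⊎_)
open import Data.Unit using (⊤)
open import Data.Empty using (⊥)
open import Relation.Binary.PropositionalEquality using (_≡_; _≢_)
open import Relation.Nullary using (¬_)
open import Function using (_⇔_)
open import Function.Definitions using (Injective)

record Graph : Set where
  field
    n      : ℕ
    adj    : Fin n → Fin n → Bool
    sym    : ∀ u v → adj u v ≡ adj v u
    irrefl : ∀ u → adj u u ≡ false

open Graph public

IntervalInduced : (G : Graph) → Subset (n G) → Set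
IntervalInduced G X =
  Σ (Fin (n G) → ℚ) λ lo → Σ (Fin (n G) → ℚ) λ hi →
    (∀ u → u ∈ X → lo u ≤ℚ hi u) ×
    (∀ u v → u ∈ X → v ∈ X → u ≢ v →
       (adj G u v ≡ true ⇔ (lo u ≤ℚ hi v × lo v ≤ℚ hi u)))

MinimalForbidden : (G : Graph) → Subset (n G) → Set
MinimalForbidden G X =
  ¬ IntervalInduced G X × (∀ Y → Y ⊂ X → IntervalInduced G Y)

Prereduced : Graph → Set
Prereduced G = ∀ X → ∣ X ∣ ≤ 10 → ¬ MinimalForbidden G X

-- index i of b_0 … b_{d+1} lies in the base {1,…,d}
InBase : (d : ℕ) → Fin (suc (suc d)) → Set
InBase d i = (1 ≤ toℕ i) × (toℕ i ≤ d)

-- †-AW (s:c:l,B,r): vertices s, c, b_0 … b_{d+1}  (b_0 = l, b_{d+1} = r)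

data DagV (d : ℕ) : Set where
  S : DagV d
  C : DagV d
  B : Fin (suc (suc d)) → DagV d

dagE₀ : (d : ℕ) → DagV d → DagV d → Set
dagE₀ d (B i) (B j) = toℕ j ≡ suc (toℕ i)
dagE₀ d C S       = ⊤
dagE₀ d C (B i)   = InBase d i
dagE₀ d _ _       = ⊥

dagE : (d : ℕ) → DagV d → DagV d → Set
dagE d u v = dagE₀ d u v ⊎ dagE₀ d v u

IsDagAW : (G : Graph) (d : ℕ) → (DagV d → Fin (n G)) → Set
IsDagAW G d f =
  (3 ≤ d) × Injective _≡_ _≡_ f ×
  (∀ u v → u ≢ v → (adj G (f u) (f v) ≡ true ⇔ dagE d u v))

-- ‡-AW (s:c_1,c_2:l,B,r): vertices s, c_1, c_2, b_0 … b_{d+1}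

data DDagV (d : ℕ) : Set where
  S  : DDagV d
  C₁ : DDagV d
  C₂ : DDagV d
  B  : Fin (suc (suc d)) → DDagV d

ddagE₀ : (d : ℕ) → DDagV d → DDagV d → Set
ddagE₀ d (B i) (B j) = toℕ j ≡ suc (toℕ i)
ddagE₀ d C₁ C₂     = ⊤
ddagE₀ d C₁ S      = ⊤
ddagE₀ d C₂ S      = ⊤
ddagE₀ d C₁ (B i)  = (toℕ i ≡ 0) ⊎ InBase d i
ddagE₀ d C₂ (B i)  = (toℕ i ≡ suc d) ⊎ InBase d i
ddagE₀ d _ _       = ⊥

ddagE : (d : ℕ) → DDagV d → DDagV d → Set
ddagE d u v = ddagE₀ d u v ⊎ ddagE₀ d v u

IsDDagAW : (G : Graph) (d : ℕ) → (DDagV d → Fin (n G)) → Set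
IsDDagAW G d f =
  (2 ≤ d) × Injective _≡_ _≡_ f ×
  (∀ u v → u ≢ v → (adj G (f u) (f v) ≡ true ⇔ ddagE d u v))

-- Suppose x is adjacent to all of B but not to s. Then l, r, s form an asteroidal triple
-- on at most ten vertices: l b₁ x b_d r avoids N[s], and l b₁ c s, r b_d c s (resp. l c₁ s,
-- r c₂ s) avoid N[r] and N[l]. Of three pairwise disjoint intervals the middle one separates
-- the outer two, so an asteroidal triple has no interval representation; hence these
-- vertices contain a minimal forbidden set of at most ten vertices.
module Submission where

open import Defs
open import Data.Nat as ℕ using (ℕ; zero; suc; z≤n; s≤s)
import Data.Nat.Properties as ℕ
open import Data.Fin using (Fin; toℕ; zero; suc; fromℕ; inject₁)
open import Data.Fin.Properties using (toℕ-fromℕ; toℕ-inject₁)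
open import Data.Fin.Subset using (Subset; _∈_; _⊂_; ∣_∣; inside; outside)
import Data.Fin.Subset as Subset
open import Data.Fin.Subset.Properties using (p⊂q⇒∣p∣<∣q∣; ∣⊥∣≡0)
open import Data.Fin.Subset.Induction using (Acc; acc; ⊂-wellFounded)
open import Data.Vec using ([]; _∷_; here; there)
open import Data.List using (List; []; _∷_; length)
open import Data.List.Relation.Unary.Any using (here; there)
import Data.List.Membership.Propositional as List
open import Data.Bool using (true; false)
open import Data.Bool.Properties using (¬-not)
open import Data.Rational using (ℚ; _≤_; _<_)
open import Data.Rational.Properties using (<-irrefl; ≰⇒>; _≤?_; module ≤-Reasoning)
open import Data.Product using (_×_; _,_; proj₁; proj₂)
open import Data.Sum using (_⊎_; inj₁; inj₂)
open import Data.Empty using (⊥; ⊥-elim)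
open import Relation.Binary.PropositionalEquality as ≡ using (_≡_; _≢_; refl; trans; cong; subst)
open import Relation.Nullary using (¬_; yes; no)
open import Function using (Equivalence; _⇔_; _∘_)
open import Function.Definitions using (Injective)
open Equivalence using (to; from)

module Walks (G : Graph) where

  private
    V = Fin (n G)

  adj-sym : ∀ {u v} → adj G u v ≡ true → adj G v u ≡ true
  adj-sym {u} {v} uv = trans (Graph.sym G v u) uv

  adj⇒≢ : ∀ {u v} → adj G u v ≡ true → u ≢ v
  adj⇒≢ {u} u~u refl with () ← trans (≡.sym u~u) (irrefl G u)

  adj-non-adj⇒≢ : ∀ {u w v} → adj G u v ≡ true → adj G w v ≡ false → u ≢ w
  adj-non-adj⇒≢ u~v w≁v refl with () ← trans (≡.sym u~v) w≁v

  _∈_∖N[_] : V → Subset (n G) → V → Set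
  u ∈ X ∖N[ w ] = u ∈ X × u ≢ w × adj G u w ≡ false

  infixr 5 _∷⟨_⟩_

  data AvoidingWalk (X : Subset (n G)) (w : V) : V → V → Set where
    [_]    : ∀ {u} → u ∈ X ∖N[ w ] → AvoidingWalk X w u u
    _∷⟨_⟩_ : ∀ {u v t} → u ∈ X ∖N[ w ] → adj G u v ≡ true →
             AvoidingWalk X w v t → AvoidingWalk X w u t

  module _ {X : Subset (n G)} {w : V} where

    walk-head : ∀ {u t} → AvoidingWalk X w u t → u ∈ X ∖N[ w ]
    walk-head [ u∉ ]        = u∉
    walk-head (u∉ ∷⟨ _ ⟩ _) = u∉

    walk-last : ∀ {u t} → AvoidingWalk X w u t → t ∈ X ∖N[ w ]
    walk-last [ t∉ ]       = t∉
    walk-last (_ ∷⟨ _ ⟩ p) = walk-last p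

    walk-reverse : ∀ {u t} → AvoidingWalk X w u t → AvoidingWalk X w t u
    walk-reverse p = reverse-onto p [ walk-head p ]
      where
      reverse-onto : ∀ {u v t} → AvoidingWalk X w v t → AvoidingWalk X w v u → AvoidingWalk X w t u
      reverse-onto [ _ ]          reversed = reversed
      reverse-onto (_ ∷⟨ vv′ ⟩ p) reversed = reverse-onto p (walk-head p ∷⟨ adj-sym vv′ ⟩ reversed)

  AsteroidalTriple : Subset (n G) → V → V → V → Set
  AsteroidalTriple X a b c = AvoidingWalk X c a b × AvoidingWalk X b a c × AvoidingWalk X a b c

module IntervalModel (G : Graph) {X : Subset (n G)} (lo hi : Fin (n G) → ℚ)
  (lo≤hi : ∀ u → u ∈ X → lo u ≤ hi u)
  (adj⇔meet : ∀ u v → u ∈ X → v ∈ X → u ≢ v →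
                (adj G u v ≡ true ⇔ (lo u ≤ hi v × lo v ≤ hi u))) where

  open Walks G

  private
    V = Fin (n G)

  _≺_ : V → V → Set
  u ≺ v = hi u < lo v

  ≺-asym : ∀ {u v} → u ∈ X → v ∈ X → u ≺ v → ¬ v ≺ u
  ≺-asym {u} {v} uX vX u≺v v≺u = <-irrefl refl hi-u<hi-u
    where
    open ≤-Reasoning
    hi-u<hi-u : hi u < hi u
    hi-u<hi-u = begin-strict
      hi u <⟨ u≺v ⟩ lo v ≤⟨ lo≤hi v vX ⟩ hi v <⟨ v≺u ⟩ lo u ≤⟨ lo≤hi u uX ⟩ hi u ∎

  non-adjacent⇒≺⊎≻ : ∀ {u v} → u ∈ X → v ∈ X → u ≢ v → adj G u v ≡ false → u ≺ v ⊎ v ≺ u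
  non-adjacent⇒≺⊎≻ {u} {v} uX vX u≢v u≁v with lo u ≤? hi v | lo v ≤? hi u
  ... | no  lo-u≰hi-v | _             = inj₂ (≰⇒> lo-u≰hi-v)
  ... | yes _         | no lo-v≰hi-u  = inj₁ (≰⇒> lo-v≰hi-u)
  ... | yes lo-u≤hi-v | yes lo-v≤hi-u
      with () ← trans (≡.sym u≁v) (from (adj⇔meet u v uX vX u≢v) (lo-u≤hi-v , lo-v≤hi-u))

  separated : ∀ {w u} → w ∈ X → u ∈ X ∖N[ w ] → u ≺ w ⊎ w ≺ u
  separated wX (uX , u≢w , u≁w) = non-adjacent⇒≺⊎≻ uX wX u≢w u≁w

  walk-stays-left : ∀ {w u t} → w ∈ X → AvoidingWalk X w u t → u ≺ w → t ≺ w
  walk-stays-left wX [ _ ] u≺w = u≺w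
  walk-stays-left {w} {u} wX (_∷⟨_⟩_ {v = v} (uX , _) u~v p) u≺w with walk-head p
  ... | v∉@(vX , _) with separated wX v∉
  ...   | inj₁ v≺w = walk-stays-left wX p v≺w
  ...   | inj₂ w≺v = ⊥-elim (<-irrefl refl hi-w<hi-w)
    where
    open ≤-Reasoning
    hi-w<hi-w : hi w < hi w
    hi-w<hi-w = begin-strict
      hi w <⟨ w≺v ⟩ lo v ≤⟨ proj₂ (to (adj⇔meet u v uX vX (adj⇒≢ u~v)) u~v) ⟩ hi u <⟨ u≺w ⟩
      lo w ≤⟨ lo≤hi w wX ⟩ hi w ∎

  walk-cannot-cross : ∀ {w u t} → w ∈ X → AvoidingWalk X w u t → u ≺ w → ¬ w ≺ t
  walk-cannot-cross wX p u≺w = ≺-asym (proj₁ (walk-last p)) wX (walk-stays-left wX p u≺w)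

  no-asteroidal-triple : ∀ {a b c} → ¬ AsteroidalTriple X a b c
  no-asteroidal-triple {a} {b} {c} (a⇝b , a⇝c , b⇝c) =
    middle (separated bX (walk-head a⇝c)) (separated cX (walk-head a⇝b)) (separated bX (walk-last a⇝c))
    where
    aX : a ∈ X
    aX = proj₁ (walk-head a⇝b)
    bX : b ∈ X
    bX = proj₁ (walk-last a⇝b)
    cX : c ∈ X
    cX = proj₁ (walk-last a⇝c)
    middle : a ≺ b ⊎ b ≺ a → a ≺ c ⊎ c ≺ a → c ≺ b ⊎ b ≺ c → ⊥
    middle (inj₁ a≺b) (inj₁ a≺c) (inj₂ b≺c) = walk-cannot-cross bX a⇝c a≺b b≺c
    middle (inj₁ a≺b) (inj₁ a≺c) (inj₁ c≺b) = walk-cannot-cross cX a⇝b a≺c c≺b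
    middle (inj₁ a≺b) (inj₂ c≺a) _          = walk-cannot-cross aX (walk-reverse b⇝c) c≺a a≺b
    middle (inj₂ b≺a) (inj₁ a≺c) _          = walk-cannot-cross aX b⇝c b≺a a≺c
    middle (inj₂ b≺a) (inj₂ c≺a) (inj₂ b≺c) = walk-cannot-cross cX (walk-reverse a⇝b) b≺c c≺a
    middle (inj₂ b≺a) (inj₂ c≺a) (inj₁ c≺b) = walk-cannot-cross bX (walk-reverse a⇝c) c≺b b≺a

asteroidal⇒¬interval : ∀ G {X a b c} → Walks.AsteroidalTriple G X a b c → ¬ IntervalInduced G X
asteroidal⇒¬interval G triple (lo , hi , lo≤hi , adj⇔meet) =
  IntervalModel.no-asteroidal-triple G lo hi lo≤hi adj⇔meet triple

¬¬-∀-Subset : ∀ m (P : Subset m → Set) → (∀ X → ¬ ¬ P X) → ¬ ¬ (∀ X → P X)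
¬¬-∀-Subset zero    P ¬¬P ¬∀P = ¬¬P [] (λ P[] → ¬∀P λ { [] → P[] })
¬¬-∀-Subset (suc m) P ¬¬P ¬∀P =
  ¬¬-∀-Subset m (λ X → P (inside ∷ X)) (λ X → ¬¬P (inside ∷ X)) λ ∀P-inside →
  ¬¬-∀-Subset m (λ X → P (outside ∷ X)) (λ X → ¬¬P (outside ∷ X)) λ ∀P-outside →
  ¬∀P λ { (inside ∷ X) → ∀P-inside X ; (outside ∷ X) → ∀P-outside X }

¬¬-→ : {A B : Set} → (A → ¬ ¬ B) → ¬ ¬ (A → B)
¬¬-→ ¬¬B ¬[A→B] = ¬[A→B] λ a → ⊥-elim (¬¬B a λ b → ¬[A→B] λ _ → b)

-- Interval representability is not decidable, so a minimal forbidden subset of a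
-- non-interval set is only reached under double negation.
prereduced⇒¬¬interval : ∀ {G} → Prereduced G → ∀ X → ∣ X ∣ ℕ.≤ 10 → ¬ ¬ IntervalInduced G X
prereduced⇒¬¬interval {G} pre X = go X (⊂-wellFounded X)
  where
  go : ∀ X → Acc _⊂_ X → ∣ X ∣ ℕ.≤ 10 → ¬ ¬ IntervalInduced G X
  go X (acc smaller) ∣X∣≤10 ¬interval =
    ¬¬-∀-Subset (n G) (λ Y → Y ⊂ X → IntervalInduced G Y)
      (λ Y → ¬¬-→ λ Y⊂X → go Y (smaller Y⊂X) (ℕ.≤-trans (ℕ.<⇒≤ (p⊂q⇒∣p∣<∣q∣ Y⊂X)) ∣X∣≤10))
      (λ subsets-interval → pre X ∣X∣≤10 (¬interval , subsets-interval))

insert : ∀ {m} → Fin m → Subset m → Subset m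
insert zero    (_ ∷ X) = inside ∷ X
insert (suc i) (b ∷ X) = b ∷ insert i X

∣insert∣≤ : ∀ {m} (i : Fin m) (X : Subset m) → ∣ insert i X ∣ ℕ.≤ suc ∣ X ∣
∣insert∣≤ zero    (outside ∷ X) = ℕ.≤-refl
∣insert∣≤ zero    (inside ∷ X)  = ℕ.n≤1+n _
∣insert∣≤ (suc i) (outside ∷ X) = ∣insert∣≤ i X
∣insert∣≤ (suc i) (inside ∷ X)  = s≤s (∣insert∣≤ i X)

i∈insert : ∀ {m} (i : Fin m) (X : Subset m) → i ∈ insert i X
i∈insert zero    (_ ∷ X) = here
i∈insert (suc i) (_ ∷ X) = there (i∈insert i X)

insert-⊇ : ∀ {m} (i : Fin m) {j} {X : Subset m} → j ∈ X → j ∈ insert i X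
insert-⊇ zero    here        = here
insert-⊇ zero    (there j∈X) = there j∈X
insert-⊇ (suc i) here        = here
insert-⊇ (suc i) (there j∈X) = there (insert-⊇ i j∈X)

fromList : ∀ {m} → List (Fin m) → Subset m
fromList []       = Subset.⊥
fromList (i ∷ is) = insert i (fromList is)

∣fromList∣≤length : ∀ {m} (is : List (Fin m)) → ∣ fromList is ∣ ℕ.≤ length is
∣fromList∣≤length {m} []  = ℕ.≤-reflexive (∣⊥∣≡0 m)
∣fromList∣≤length (i ∷ is) = ℕ.≤-trans (∣insert∣≤ i (fromList is)) (s≤s (∣fromList∣≤length is))

∈-fromList : ∀ {m} {i : Fin m} {is} → i List.∈ is → i ∈ fromList is
∈-fromList {is = j ∷ is} (here refl) = i∈insert j (fromList is)
∈-fromList {is = j ∷ is} (there i∈is) = insert-⊇ j (∈-fromList i∈is)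

no-small-asteroidal-triple : ∀ {G} → Prereduced G → (is : List (Fin (n G))) → length is ℕ.≤ 10 →
  ∀ {a b c} → ¬ Walks.AsteroidalTriple G (fromList is) a b c
no-small-asteroidal-triple {G} pre is |is|≤10 triple =
  prereduced⇒¬¬interval {G} pre (fromList is) (ℕ.≤-trans (∣fromList∣≤length is) |is|≤10)
    (asteroidal⇒¬interval G triple)

module InducedCopy (G : Graph) {V : Set} (E : V → V → Set) (f : V → Fin (n G))
  (f-injective : Injective _≡_ _≡_ f)
  (f-induced : ∀ u v → u ≢ v → (adj G (f u) (f v) ≡ true ⇔ E u v)) where

  open Walks G

  edge⇒adj : ∀ {u v} → u ≢ v → E u v → adj G (f u) (f v) ≡ true
  edge⇒adj {u} {v} u≢v uv = from (f-induced u v u≢v) uv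

  non-edge⇒non-adj : ∀ {u v} → u ≢ v → ¬ E u v → adj G (f u) (f v) ≡ false
  non-edge⇒non-adj {u} {v} u≢v ¬uv = ¬-not λ u~v → ¬uv (to (f-induced u v u≢v) u~v)

  image-∉N : ∀ {X u w} → f u ∈ X → u ≢ w → ¬ E u w → f u ∈ X ∖N[ f w ]
  image-∉N fu∈X u≢w ¬uw = fu∈X , (λ fu≡fw → u≢w (f-injective fu≡fw)) , non-edge⇒non-adj u≢w ¬uw

module BaseIndices (d : ℕ) where

  l b₁ bd r : Fin (suc (suc d))
  l   = zero
  b₁  = suc zero
  bd  = inject₁ (fromℕ d)
  r   = fromℕ (suc d)

  toℕ-bd : toℕ bd ≡ d
  toℕ-bd = trans (toℕ-inject₁ (fromℕ d)) (toℕ-fromℕ d)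

  toℕ-r : toℕ r ≡ suc d
  toℕ-r = toℕ-fromℕ (suc d)

  r-follows-bd : toℕ r ≡ suc (toℕ bd)
  r-follows-bd = trans toℕ-r (cong suc (≡.sym toℕ-bd))

  bd≢r : bd ≢ r
  bd≢r bd≡r = ℕ.1+n≢n (trans (≡.sym r-follows-bd) (cong toℕ (≡.sym bd≡r)))

  b₁∈B : 1 ℕ.≤ d → InBase d b₁
  b₁∈B 1≤d = s≤s z≤n , 1≤d

  bd∈B : 1 ℕ.≤ d → InBase d bd
  bd∈B 1≤d = subst (1 ℕ.≤_) (≡.sym toℕ-bd) 1≤d , ℕ.≤-reflexive toℕ-bd

  r∉B : ¬ InBase d r
  r∉B (_ , r≤d) = ℕ.1+n≰n (subst (ℕ._≤ d) toℕ-r r≤d)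

adj-shallow-†AW : (G : Graph) → Prereduced G → (d : ℕ) (f : DagV d → Fin (n G)) → IsDagAW G d f →
  ∀ x → (∀ i → InBase d i → adj G x (f (B i)) ≡ true) → adj G x (f S) ≡ true
adj-shallow-†AW G pre d f (s≤s (s≤s (s≤s _)) , f-injective , f-induced) x x~B =
  ¬-not λ x≁s → no-small-asteroidal-triple pre vertices (ℕ.m≤m+n 7 3) (l⇝r x≁s , l⇝s , r⇝s)
  where
  open Walks G
  open InducedCopy G (dagE d) f f-injective f-induced
  open BaseIndices d

  vertices : List (Fin (n G))
  vertices = x ∷ f S ∷ f C ∷ f (B l) ∷ f (B b₁) ∷ f (B bd) ∷ f (B r) ∷ []

  X : Subset (n G)
  X = fromList vertices

  ∈X : ∀ {v} → v List.∈ vertices → v ∈ X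
  ∈X = ∈-fromList

  B-≢ : ∀ {i j} → i ≢ j → DagV.B {d} i ≢ B j
  B-≢ i≢j refl = i≢j refl

  x~b₁ : adj G x (f (B b₁)) ≡ true
  x~b₁ = x~B b₁ (b₁∈B (s≤s z≤n))

  s≁b₁ : adj G (f S) (f (B b₁)) ≡ false
  s≁b₁ = non-edge⇒non-adj (λ ()) λ { (inj₁ ()) ; (inj₂ ()) }

  x∈X : x ∈ X
  x∈X = ∈X (here refl)
  s∈X : f S ∈ X
  s∈X = ∈X (there (here refl))
  c∈X : f C ∈ X
  c∈X = ∈X (there (there (here refl)))
  l∈X : f (B l) ∈ X
  l∈X = ∈X (there (there (there (here refl))))
  b₁∈X : f (B b₁) ∈ X
  b₁∈X = ∈X (there (there (there (there (here refl)))))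
  bd∈X : f (B bd) ∈ X
  bd∈X = ∈X (there (there (there (there (there (here refl))))))
  r∈X : f (B r) ∈ X
  r∈X = ∈X (there (there (there (there (there (there (here refl)))))))

  l⇝r : adj G x (f S) ≡ false → AvoidingWalk X (f S) (f (B l)) (f (B r))
  l⇝r x≁s =
    image-∉N l∈X (λ ()) (λ { (inj₁ ()) ; (inj₂ ()) }) ∷⟨ edge⇒adj (λ ()) (inj₁ refl) ⟩
    image-∉N b₁∈X (λ ()) (λ { (inj₁ ()) ; (inj₂ ()) }) ∷⟨ adj-sym x~b₁ ⟩
    (x∈X , adj-non-adj⇒≢ x~b₁ s≁b₁ , x≁s) ∷⟨ x~B bd (bd∈B (s≤s z≤n)) ⟩
    image-∉N bd∈X (λ ()) (λ { (inj₁ ()) ; (inj₂ ()) }) ∷⟨ edge⇒adj (B-≢ bd≢r) (inj₁ r-follows-bd) ⟩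
    [ image-∉N r∈X (λ ()) (λ { (inj₁ ()) ; (inj₂ ()) }) ]

  l⇝s : AvoidingWalk X (f (B r)) (f (B l)) (f S)
  l⇝s =
    image-∉N l∈X (λ ()) (λ { (inj₁ ()) ; (inj₂ ()) }) ∷⟨ edge⇒adj (λ ()) (inj₁ refl) ⟩
    image-∉N b₁∈X (λ ()) (λ { (inj₁ ()) ; (inj₂ ()) }) ∷⟨ edge⇒adj (λ ()) (inj₂ (b₁∈B (s≤s z≤n))) ⟩
    image-∉N c∈X (λ ()) (λ { (inj₁ r∈B) → r∉B r∈B ; (inj₂ ()) }) ∷⟨ edge⇒adj (λ ()) (inj₁ _) ⟩
    [ image-∉N s∈X (λ ()) (λ { (inj₁ ()) ; (inj₂ ()) }) ]

  r⇝s : AvoidingWalk X (f (B l)) (f (B r)) (f S)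
  r⇝s =
    image-∉N r∈X (λ ()) (λ { (inj₁ ()) ; (inj₂ ()) }) ∷⟨ edge⇒adj (B-≢ (bd≢r ∘ ≡.sym)) (inj₂ r-follows-bd) ⟩
    image-∉N bd∈X (λ ()) (λ { (inj₁ ()) ; (inj₂ ()) }) ∷⟨ edge⇒adj (λ ()) (inj₂ (bd∈B (s≤s z≤n))) ⟩
    image-∉N c∈X (λ ()) (λ { (inj₁ (() , _)) ; (inj₂ ()) }) ∷⟨ edge⇒adj (λ ()) (inj₁ _) ⟩
    [ image-∉N s∈X (λ ()) (λ { (inj₁ ()) ; (inj₂ ()) }) ]

adj-shallow-‡AW : (G : Graph) → Prereduced G → (d : ℕ) (f : DDagV d → Fin (n G)) → IsDDagAW G d f →
  ∀ x → (∀ i → InBase d i → adj G x (f (B i)) ≡ true) → adj G x (f S) ≡ true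
adj-shallow-‡AW G pre d f (s≤s (s≤s _) , f-injective , f-induced) x x~B =
  ¬-not λ x≁s → no-small-asteroidal-triple pre vertices (ℕ.m≤m+n 8 2) (l⇝r x≁s , l⇝s , r⇝s)
  where
  open Walks G
  open InducedCopy G (ddagE d) f f-injective f-induced
  open BaseIndices d

  vertices : List (Fin (n G))
  vertices = x ∷ f S ∷ f C₁ ∷ f C₂ ∷ f (B l) ∷ f (B b₁) ∷ f (B bd) ∷ f (B r) ∷ []

  X : Subset (n G)
  X = fromList vertices

  ∈X : ∀ {v} → v List.∈ vertices → v ∈ X
  ∈X = ∈-fromList

  x∈X : x ∈ X
  x∈X = ∈X (here refl)
  s∈X : f S ∈ X
  s∈X = ∈X (there (here refl))
  c₁∈X : f C₁ ∈ X
  c₁∈X = ∈X (there (there (here refl)))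
  c₂∈X : f C₂ ∈ X
  c₂∈X = ∈X (there (there (there (here refl))))
  l∈X : f (B l) ∈ X
  l∈X = ∈X (there (there (there (there (here refl)))))
  b₁∈X : f (B b₁) ∈ X
  b₁∈X = ∈X (there (there (there (there (there (here refl))))))
  bd∈X : f (B bd) ∈ X
  bd∈X = ∈X (there (there (there (there (there (there (here refl)))))))
  r∈X : f (B r) ∈ X
  r∈X = ∈X (there (there (there (there (there (there (there (here refl))))))))

  B-≢ : ∀ {i j} → i ≢ j → DDagV.B {d} i ≢ B j
  B-≢ i≢j refl = i≢j refl

  x~b₁ : adj G x (f (B b₁)) ≡ true
  x~b₁ = x~B b₁ (b₁∈B (s≤s z≤n))

  s≁b₁ : adj G (f S) (f (B b₁)) ≡ false
  s≁b₁ = non-edge⇒non-adj (λ ()) λ { (inj₁ ()) ; (inj₂ ()) }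

  l⇝r : adj G x (f S) ≡ false → AvoidingWalk X (f S) (f (B l)) (f (B r))
  l⇝r x≁s =
    image-∉N l∈X (λ ()) (λ { (inj₁ ()) ; (inj₂ ()) }) ∷⟨ edge⇒adj (λ ()) (inj₁ refl) ⟩
    image-∉N b₁∈X (λ ()) (λ { (inj₁ ()) ; (inj₂ ()) }) ∷⟨ adj-sym x~b₁ ⟩
    (x∈X , adj-non-adj⇒≢ x~b₁ s≁b₁ , x≁s) ∷⟨ x~B bd (bd∈B (s≤s z≤n)) ⟩
    image-∉N bd∈X (λ ()) (λ { (inj₁ ()) ; (inj₂ ()) }) ∷⟨ edge⇒adj (B-≢ bd≢r) (inj₁ r-follows-bd) ⟩
    [ image-∉N r∈X (λ ()) (λ { (inj₁ ()) ; (inj₂ ()) }) ]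

  l⇝s : AvoidingWalk X (f (B r)) (f (B l)) (f S)
  l⇝s =
    image-∉N l∈X (λ ()) (λ { (inj₁ ()) ; (inj₂ ()) }) ∷⟨ edge⇒adj (λ ()) (inj₂ (inj₁ refl)) ⟩
    image-∉N c₁∈X (λ ()) (λ { (inj₁ (inj₁ ())) ; (inj₁ (inj₂ r∈B)) → r∉B r∈B ; (inj₂ ()) })
      ∷⟨ edge⇒adj (λ ()) (inj₁ _) ⟩
    [ image-∉N s∈X (λ ()) (λ { (inj₁ ()) ; (inj₂ ()) }) ]

  r⇝s : AvoidingWalk X (f (B l)) (f (B r)) (f S)
  r⇝s =
    image-∉N r∈X (λ ()) (λ { (inj₁ ()) ; (inj₂ ()) }) ∷⟨ edge⇒adj (λ ()) (inj₂ (inj₁ toℕ-r)) ⟩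
    image-∉N c₂∈X (λ ()) (λ { (inj₁ (inj₁ ())) ; (inj₁ (inj₂ (() , _))) ; (inj₂ ()) })
      ∷⟨ edge⇒adj (λ ()) (inj₁ _) ⟩
    [ image-∉N s∈X (λ ()) (λ { (inj₁ ()) ; (inj₂ ()) }) ]

lemma5p1 : (G : Graph) → Prereduced G →
    ((d : ℕ) (f : DagV d → Fin (n G)) → IsDagAW G d f →
       ∀ x → (∀ i → InBase d i → adj G x (f (B i)) ≡ true) → adj G x (f S) ≡ true)
    × ((d : ℕ) (f : DDagV d → Fin (n G)) → IsDDagAW G d f →
       ∀ x → (∀ i → InBase d i → adj G x (f (B i)) ≡ true) → adj G x (f S) ≡ true)
lemma5p1 G pre = adj-shallow-†AW G pre , adj-shallow-‡AW G pre
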